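{- Let $E$ be a finite set, $e\in E$, and let $S\subseteq 2^E$ be such that $e$ is a coloop of $S$, i.e. there is $T\subseteq 2^{E\setminus\{e\}}$ with $S=\{X\mid X\in T\}\cup\{X\cup\{e\}\mid X\in T\}$. If $S/e:=\{X\subseteq E\setminus\{e\}\mid X\in S\}$ (which equals $T$) is a powerful set with ground set $E\setminus\{e\}$, then $S$ is a powerful set.
   Context: For a finite ground set $E$, a family $S\subseteq 2^E$ is called a powerful set if for every $X\subseteq E$ the number of members $Y\in S$ with $Y\cap X=\emptyset$ is a power of $2$. -}

module Defs where

open import Data.Nat using (ℕ; zero; suc; _^_)
open import Data.Bool using (Bool; true; false; _∧_; _∨_; not)
open import Data.Fin using (Fin)
open import Data.Fin.Subset using (Subset; inside; outside)
open import Data.Vec using (Vec; []; _∷_; insertAt)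
open import Data.List using (List; []; _∷_; map; _++_; length; filterᵇ)
open import Data.Product using (Σ; ∃; _×_)
open import Data.Sum using (_⊎_)
open import Relation.Binary.PropositionalEquality using (_≡_)

-- The ground set E is Fin n; a subset of E is a 'Subset n' (Vec Bool n,
-- true = inside).  A family S ⊆ 2^E is given by its (Boolean)
-- characteristic function; it is automatically finite.
Family : ℕ → Set
Family n = Subset n → Bool

allSubsets : (n : ℕ) → List (Subset n)
allSubsets zero    = [] ∷ []
allSubsets (suc n) = map (outside ∷_) (allSubsets n) ++ map (inside ∷_) (allSubsets n)

disjointᵇ : {n : ℕ} → Subset n → Subset n → Bool
disjointᵇ []       []       = true
disjointᵇ (y ∷ ys) (x ∷ xs) = not (y ∧ x) ∧ disjointᵇ ys xs

countDisjoint : {n : ℕ} → Family n → Subset n → ℕ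
countDisjoint {n} S X = length (filterᵇ (λ Y → S Y ∧ disjointᵇ Y X) (allSubsets n))

Powerful : (n : ℕ) → Family n → Set
Powerful n S = (X : Subset n) → ∃ λ k → countDisjoint S X ≡ 2 ^ k

-- Subsets of E ∖ {e} (E = Fin (suc n)) are identified with Subset n;
-- 'insertAt X e b' is X viewed in E, with e added iff b = inside.
-- e is a coloop of S: ∃ T ⊆ 2^(E∖{e}) with S = {X | X ∈ T} ∪ {X ∪ {e} | X ∈ T}.
IsColoop : {n : ℕ} → Family (suc n) → Fin (suc n) → Set
IsColoop {n} S e =
  Σ (Family n) λ T → (Y : Subset (suc n)) →
    (S Y ≡ true → ∃ λ X → T X ≡ true × (Y ≡ insertAt X e outside ⊎ Y ≡ insertAt X e inside))
    × ((∃ λ X → T X ≡ true × (Y ≡ insertAt X e outside ⊎ Y ≡ insertAt X e inside)) → S Y ≡ true)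

contract : {n : ℕ} → Family (suc n) → Fin (suc n) → Family n
contract S e X = S (insertAt X e outside)

-- Write a subset of E as X or X ∪ {e} with X ⊆ E ∖ {e}, and a member of S as
-- Z or Z ∪ {e}; since e is a coloop, both lie in S exactly when Z ∈ S/e.
-- If e ∉ X, both avoid X iff Z does, so 2c members of S avoid X, where c is
-- the number of members of S/e avoiding X; if e ∈ X only the members Z can
-- avoid X, giving c.
module Submission where

open import Defs
open import Algebra.Properties.CommutativeSemigroup using (interchange)
open import Data.Bool using (Bool; true; false; T?; _∧_; not)
open import Data.Bool.Properties using (∧-assoc; ∧-comm; ∧-zeroʳ; ⇔→≡)
open import Data.Fin using (Fin; zero; suc)
open import Data.Fin.Subset using (Subset; inside; outside)
open import Data.List using (List; []; _∷_; map; _++_; length; filterᵇ)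
open import Data.List.Properties using (length-++; filter-++)
open import Data.Nat using (ℕ; suc; _+_; _^_)
open import Data.Nat.Properties using (+-identityʳ; +-commutativeSemigroup)
open import Data.Product using (∃; _,_; proj₁; proj₂; map₂)
open import Data.Sum using (_⊎_; inj₁; inj₂; [_,_])
open import Data.Vec using (Vec; _∷_; insertAt; removeAt; lookup)
open import Data.Vec.Properties using (insertAt-removeAt; removeAt-insertAt)
open import Function using (_∘_)
open import Function.Bundles using (mk⇔)
open import Relation.Binary.PropositionalEquality
  using (_≡_; refl; sym; trans; cong; cong₂; subst; module ≡-Reasoning)
open ≡-Reasoning

private
  variable
    n : ℕ

countᵇ : {A : Set} → (A → Bool) → List A → ℕ
countᵇ p xs = length (filterᵇ p xs)

module _ {A : Set} where

  countᵇ-++ : (p : A → Bool) (xs ys : List A) →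
              countᵇ p (xs ++ ys) ≡ countᵇ p xs + countᵇ p ys
  countᵇ-++ p xs ys =
    trans (cong length (filter-++ (T? ∘ p) xs ys)) (length-++ (filterᵇ p xs))

  countᵇ-map : {B : Set} (p : B → Bool) (f : A → B) (xs : List A) →
               countᵇ p (map f xs) ≡ countᵇ (p ∘ f) xs
  countᵇ-map p f []       = refl
  countᵇ-map p f (x ∷ xs) with p (f x)
  ... | true  = cong suc (countᵇ-map p f xs)
  ... | false = countᵇ-map p f xs

  countᵇ-cong : {p q : A → Bool} → (∀ x → p x ≡ q x) → (xs : List A) →
                countᵇ p xs ≡ countᵇ q xs
  countᵇ-cong {p} {q} p≗q []       = refl
  countᵇ-cong {p} {q} p≗q (x ∷ xs) with p x | q x | p≗q x
  ... | true  | .true  | refl = cong suc (countᵇ-cong p≗q xs)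
  ... | false | .false | refl = countᵇ-cong p≗q xs

  countᵇ-none : {p : A → Bool} → (∀ x → p x ≡ false) → (xs : List A) →
                countᵇ p xs ≡ 0
  countᵇ-none {p} none []       = refl
  countᵇ-none {p} none (x ∷ xs) with p x | none x
  ... | .false | refl = countᵇ-none none xs

countᵇ-allSubsets-head : (p : Subset (suc n) → Bool) →
  countᵇ p (allSubsets (suc n)) ≡
  countᵇ (p ∘ (outside ∷_)) (allSubsets n) + countᵇ (p ∘ (inside ∷_)) (allSubsets n)
countᵇ-allSubsets-head {n} p =
  trans (countᵇ-++ p (map (outside ∷_) (allSubsets n)) _)
        (cong₂ _+_ (countᵇ-map p _ (allSubsets n)) (countᵇ-map p _ (allSubsets n)))

countᵇ-allSubsets-insertAt : (e : Fin (suc n)) (p : Subset (suc n) → Bool) →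
  countᵇ p (allSubsets (suc n)) ≡
  countᵇ (λ Z → p (insertAt Z e outside)) (allSubsets n) +
  countᵇ (λ Z → p (insertAt Z e inside)) (allSubsets n)
countᵇ-allSubsets-insertAt zero p = countᵇ-allSubsets-head p
countᵇ-allSubsets-insertAt {suc n} (suc e) p = begin
  countᵇ p (allSubsets (suc (suc n)))
    ≡⟨ countᵇ-allSubsets-head p ⟩
  countᵇ (p ∘ (outside ∷_)) (allSubsets (suc n)) + countᵇ (p ∘ (inside ∷_)) (allSubsets (suc n))
    ≡⟨ cong₂ _+_ (countᵇ-allSubsets-insertAt e (p ∘ (outside ∷_)))
                 (countᵇ-allSubsets-insertAt e (p ∘ (inside ∷_))) ⟩
  (count outside outside + count outside inside) + (count inside outside + count inside inside)
    ≡⟨ interchange +-commutativeSemigroup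
         (count outside outside) (count outside inside) (count inside outside) (count inside inside) ⟩
  (count outside outside + count inside outside) + (count outside inside + count inside inside)
    ≡⟨ cong₂ _+_ (countᵇ-allSubsets-head (λ Y → p (insertAt Y (suc e) outside)))
                 (countᵇ-allSubsets-head (λ Y → p (insertAt Y (suc e) inside))) ⟨
  countᵇ (λ Z → p (insertAt Z (suc e) outside)) (allSubsets (suc n)) +
  countᵇ (λ Z → p (insertAt Z (suc e) inside)) (allSubsets (suc n)) ∎
  where
  count : Bool → Bool → ℕ
  count h b = countᵇ (λ Z → p (h ∷ insertAt Z e b)) (allSubsets n)

disjointᵇ-insertAt : (e : Fin (suc n)) (Z X : Subset n) (b x : Bool) →
  disjointᵇ (insertAt Z e b) (insertAt X e x) ≡ not (b ∧ x) ∧ disjointᵇ Z X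
disjointᵇ-insertAt zero Z X b x = refl
disjointᵇ-insertAt (suc e) (z ∷ Z) (y ∷ X) b x = begin
  not (z ∧ y) ∧ disjointᵇ (insertAt Z e b) (insertAt X e x)
    ≡⟨ cong (not (z ∧ y) ∧_) (disjointᵇ-insertAt e Z X b x) ⟩
  not (z ∧ y) ∧ (not (b ∧ x) ∧ disjointᵇ Z X)
    ≡⟨ ∧-assoc (not (z ∧ y)) _ _ ⟨
  (not (z ∧ y) ∧ not (b ∧ x)) ∧ disjointᵇ Z X
    ≡⟨ cong (_∧ disjointᵇ Z X) (∧-comm (not (z ∧ y)) (not (b ∧ x))) ⟩
  (not (b ∧ x) ∧ not (z ∧ y)) ∧ disjointᵇ Z X
    ≡⟨ ∧-assoc (not (b ∧ x)) _ _ ⟩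
  not (b ∧ x) ∧ (not (z ∧ y) ∧ disjointᵇ Z X) ∎

fibre : Family (suc n) → Fin (suc n) → Bool → Family n
fibre S e b Z = S (insertAt Z e b)

countDisjoint-cong : {S S′ : Family n} → (∀ Z → S Z ≡ S′ Z) → (X : Subset n) →
                     countDisjoint S X ≡ countDisjoint S′ X
countDisjoint-cong {n} S≗S′ X =
  countᵇ-cong (λ Z → cong (_∧ disjointᵇ Z X) (S≗S′ Z)) (allSubsets n)

countDisjoint-insertAt : (S : Family (suc n)) (e : Fin (suc n)) (X : Subset n) (x : Bool) →
  countDisjoint S (insertAt X e x) ≡
  countDisjoint (fibre S e outside) X +
  countᵇ (λ Z → fibre S e inside Z ∧ (not x ∧ disjointᵇ Z X)) (allSubsets n)
countDisjoint-insertAt {n} S e X x =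
  trans (countᵇ-allSubsets-insertAt e (λ Y → S Y ∧ disjointᵇ Y (insertAt X e x)))
        (cong₂ _+_ (countᵇ-cong (disjoint outside) (allSubsets n))
                   (countᵇ-cong (disjoint inside) (allSubsets n)))
  where
  disjoint : ∀ b Z → fibre S e b Z ∧ disjointᵇ (insertAt Z e b) (insertAt X e x)
                   ≡ fibre S e b Z ∧ (not (b ∧ x) ∧ disjointᵇ Z X)
  disjoint b Z = cong (fibre S e b Z ∧_) (disjointᵇ-insertAt e Z X b x)

countDisjoint-insertAt-inside : (S : Family (suc n)) (e : Fin (suc n)) (X : Subset n) →
  countDisjoint S (insertAt X e inside) ≡ countDisjoint (fibre S e outside) X
countDisjoint-insertAt-inside {n} S e X = begin
  countDisjoint S (insertAt X e inside)
    ≡⟨ countDisjoint-insertAt S e X inside ⟩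
  countDisjoint (fibre S e outside) X + countᵇ (λ Z → fibre S e inside Z ∧ false) (allSubsets n)
    ≡⟨ cong (countDisjoint (fibre S e outside) X +_)
            (countᵇ-none (∧-zeroʳ ∘ fibre S e inside) (allSubsets n)) ⟩
  countDisjoint (fibre S e outside) X + 0
    ≡⟨ +-identityʳ _ ⟩
  countDisjoint (fibre S e outside) X ∎

insertAt-injectiveˡ : {A : Set} {xs ys : Vec A n} (i : Fin (suc n)) {x y : A} →
                      insertAt xs i x ≡ insertAt ys i y → xs ≡ ys
insertAt-injectiveˡ {xs = xs} {ys} i {x} {y} eq = begin
  xs                          ≡⟨ removeAt-insertAt xs i x ⟨
  removeAt (insertAt xs i x) i ≡⟨ cong (λ v → removeAt v i) eq ⟩
  removeAt (insertAt ys i y) i ≡⟨ removeAt-insertAt ys i y ⟩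
  ys                          ∎

coloop-fibre : {S : Family (suc n)} {e : Fin (suc n)} (coloop : IsColoop S e) →
               (b : Bool) (Z : Subset n) → fibre S e b Z ≡ proj₁ coloop Z
coloop-fibre {S = S} {e} (T , S≐T) b Z = ⇔→≡ (mk⇔ fibre⇒T T⇒fibre)
  where
  fibre⇒T : fibre S e b Z ≡ true → T Z ≡ true
  fibre⇒T Y∈S with proj₁ (S≐T (insertAt Z e b)) Y∈S
  ... | X , X∈T , Y≡X⊎Y≡X+e =
    subst (λ W → T W ≡ true) (sym ([ insertAt-injectiveˡ e , insertAt-injectiveˡ e ] Y≡X⊎Y≡X+e)) X∈T

  insertAt-outside-or-inside : ∀ b → insertAt Z e b ≡ insertAt Z e outside ⊎ insertAt Z e b ≡ insertAt Z e inside
  insertAt-outside-or-inside false = inj₁ refl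
  insertAt-outside-or-inside true  = inj₂ refl

  T⇒fibre : T Z ≡ true → fibre S e b Z ≡ true
  T⇒fibre Z∈T = proj₂ (S≐T (insertAt Z e b)) (Z , Z∈T , insertAt-outside-or-inside b)

coloop-countDisjoint-outside : {S : Family (suc n)} {e : Fin (suc n)} → IsColoop S e →
  (X : Subset n) → countDisjoint S (insertAt X e outside) ≡
                   countDisjoint (contract S e) X + countDisjoint (contract S e) X
coloop-countDisjoint-outside {S = S} {e} coloop X = begin
  countDisjoint S (insertAt X e outside)
    ≡⟨ countDisjoint-insertAt S e X outside ⟩
  countDisjoint (contract S e) X + countDisjoint (fibre S e inside) X
    ≡⟨ cong (countDisjoint (contract S e) X +_) (countDisjoint-cong inside≗outside X) ⟩
  countDisjoint (contract S e) X + countDisjoint (contract S e) X ∎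
  where
  inside≗outside : ∀ Z → fibre S e inside Z ≡ contract S e Z
  inside≗outside Z = trans (coloop-fibre coloop inside Z) (sym (coloop-fibre coloop outside Z))

theorem3 : (n : ℕ) (e : Fin (suc n)) (S : Family (suc n)) →
    IsColoop S e → Powerful n (contract S e) → Powerful (suc n) S
theorem3 n e S coloop powerful X =
  subst (λ X → ∃ λ k → countDisjoint S X ≡ 2 ^ k) (insertAt-removeAt X e)
        (powerful-insertAt (removeAt X e) (lookup X e))
  where
  powerful-insertAt : ∀ X′ x → ∃ λ k → countDisjoint S (insertAt X′ e x) ≡ 2 ^ k
  powerful-insertAt X′ outside with k , c≡2^k ← powerful X′ = suc k , (begin
    countDisjoint S (insertAt X′ e outside)
      ≡⟨ coloop-countDisjoint-outside coloop X′ ⟩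
    countDisjoint (contract S e) X′ + countDisjoint (contract S e) X′
      ≡⟨ cong₂ _+_ c≡2^k c≡2^k ⟩
    2 ^ k + 2 ^ k
      ≡⟨ cong (2 ^ k +_) (+-identityʳ (2 ^ k)) ⟨
    2 ^ suc k ∎)
  powerful-insertAt X′ inside = map₂ (trans (countDisjoint-insertAt-inside S e X′)) (powerful X′)
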